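{- There is an absolute constant $C$ such that for every positive integer $r$ and every integer $N>Cr^2$, there exists a set $S\subseteq\mathbb{Z}/N\mathbb{Z}$ with $|S|=r$ such that whenever $a,b,c,d\in S$ satisfy $a-3b+3c-d=0$ in $\mathbb{Z}/N\mathbb{Z}$, we have $a=d$ and $b=c$. -}

module Defs where

open import Data.Nat using (ℕ; _+_; _*_; _%_; NonZero)
open import Data.Fin using (Fin; toℕ)
open import Relation.Binary.PropositionalEquality using (_≡_)

-- Elements of ℤ/Nℤ are represented by Fin N (residues 0..N-1).
-- a - 3b + 3c - d = 0 in ℤ/Nℤ  ⇔  a + 3c ≡ 3b + d (mod N).
Eq3 : (N : ℕ) → .{{NonZero N}} → Fin N → Fin N → Fin N → Fin N → Set
Eq3 N a b c d = (toℕ a + 3 * toℕ c) % N ≡ (3 * toℕ b + toℕ d) % N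

-- Take the integers below r, write them in base 3 and read the digit strings in base 9;
-- call the result spread i.  Then spread a + 3 spread c has base-9 digits a_j + 3 c_j ≤ 8, so
-- there are no carries and spread a + 3 spread c determines a and c.  Moreover 4 spread i ≤ 9 i²
-- (as 9^j = (3^j)²), so every such sum stays below 9r² < N: the congruence a + 3c ≡ 3b + d (mod N) on the set
-- {spread i | i < r} is an equality of natural numbers, which forces a = d and c = b.
module Submission where

open import Data.Nat
open import Data.Nat.Properties
open import Data.Nat.DivMod
open import Data.Nat.Tactic.RingSolver using (solve-∀)
open import Data.Fin using (Fin; toℕ; fromℕ<)
open import Data.Fin.Properties using (toℕ-fromℕ<; toℕ-injective; toℕ<n)
open import Data.List using (List; length; tabulate)
open import Data.List.Properties using (length-tabulate)
open import Data.List.Relation.Unary.Unique.Propositional using (Unique)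
open import Data.List.Relation.Unary.Unique.Propositional.Properties using (tabulate⁺)
open import Data.List.Membership.Propositional using (_∈_)
open import Data.List.Membership.Propositional.Properties using (∈-tabulate⁻)
open import Data.Product using (Σ; ∃; _×_; _,_; proj₁; proj₂)
open import Relation.Binary.PropositionalEquality
open import Defs

+-*-digits-unique : ∀ m .{{_ : NonZero m}} {a b a′ b′} → a < m → a′ < m →
                    a + b * m ≡ a′ + b′ * m → a ≡ a′ × b ≡ b′
+-*-digits-unique m {a} {b} {a′} {b′} a<m a′<m eq = a≡a′ , b≡b′
  where
  open ≡-Reasoning
  a≡a′ : a ≡ a′
  a≡a′ = begin
    a                ≡⟨ m<n⇒m%n≡m a<m ⟨
    a % m            ≡⟨ [m+kn]%n≡m%n a b m ⟨
    (a + b * m) % m  ≡⟨ cong (_% m) eq ⟩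
    (a′ + b′ * m) % m ≡⟨ [m+kn]%n≡m%n a′ b′ m ⟩
    a′ % m           ≡⟨ m<n⇒m%n≡m a′<m ⟩
    a′               ∎
  b≡b′ : b ≡ b′
  b≡b′ = *-cancelʳ-≡ b b′ m (+-cancelˡ-≡ a _ _ (trans eq (cong (_+ b′ * m) (sym a≡a′))))

%-/-injective : ∀ n .{{_ : NonZero n}} {i i′} → i % n ≡ i′ % n → i / n ≡ i′ / n → i ≡ i′
%-/-injective n {i} {i′} %≡ /≡ = begin
  i                  ≡⟨ m≡m%n+[m/n]*n i n ⟩
  i % n + i / n * n   ≡⟨ cong₂ (λ x y → x + y * n) %≡ /≡ ⟩
  i′ % n + i′ / n * n ≡⟨ m≡m%n+[m/n]*n i′ n ⟨
  i′                 ∎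
  where open ≡-Reasoning

%-injective-< : ∀ {n} .{{_ : NonZero n}} {x y} → x < n → y < n → x % n ≡ y % n → x ≡ y
%-injective-< x<n y<n eq = trans (sym (m<n⇒m%n≡m x<n)) (trans eq (m<n⇒m%n≡m y<n))

<3^suc⇒/3<3^ : ∀ k {i} → i < 3 ^ suc k → i / 3 < 3 ^ k
<3^suc⇒/3<3^ k i< = m<n*o⇒m/o<n (≤-trans i< (≤-reflexive (*-comm 3 (3 ^ k))))

n<3^n : ∀ n → n < 3 ^ n
n<3^n zero    = s≤s z≤n
n<3^n (suc n) = ≤-trans (+-mono-≤ (m^n>0 3 n) (n<3^n n))
                        (+-monoʳ-≤ (3 ^ n) (m≤m+n (3 ^ n) _))

spread : ℕ → ℕ → ℕ
spread zero    i = 0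
spread (suc k) i = i % 3 + 9 * spread k (i / 3)

spread-pair-suc : ∀ k i j → spread (suc k) i + 3 * spread (suc k) j ≡
                  (i % 3 + j % 3 * 3) + (spread k (i / 3) + 3 * spread k (j / 3)) * 9
spread-pair-suc k i j = rearrange (i % 3) (spread k (i / 3)) (j % 3) (spread k (j / 3))
  where
  rearrange : ∀ a X b Y → a + 9 * X + 3 * (b + 9 * Y) ≡ (a + b * 3) + (X + 3 * Y) * 9
  rearrange = solve-∀

ternary-pair<9 : ∀ i j → i % 3 + j % 3 * 3 < 9
ternary-pair<9 i j = ≤-trans (+-monoˡ-≤ (j % 3 * 3) (m%n<n i 3))
                             (+-monoʳ-≤ 3 (*-monoˡ-≤ 3 (s≤s⁻¹ (m%n<n j 3))))

spread-pair-injective : ∀ k {i j i′ j′} → i < 3 ^ k → j < 3 ^ k → i′ < 3 ^ k → j′ < 3 ^ k →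
                        spread k i + 3 * spread k j ≡ spread k i′ + 3 * spread k j′ →
                        i ≡ i′ × j ≡ j′
spread-pair-injective zero (s≤s z≤n) (s≤s z≤n) (s≤s z≤n) (s≤s z≤n) _ = refl , refl
spread-pair-injective (suc k) {i} {j} {i′} {j′} i< j< i′< j′< eq =
  %-/-injective 3 (proj₁ low) (proj₁ high) , %-/-injective 3 (proj₂ low) (proj₂ high)
  where
  nonary : i % 3 + j % 3 * 3 ≡ i′ % 3 + j′ % 3 * 3 ×
           spread k (i / 3) + 3 * spread k (j / 3) ≡ spread k (i′ / 3) + 3 * spread k (j′ / 3)
  nonary = +-*-digits-unique 9 (ternary-pair<9 i j) (ternary-pair<9 i′ j′)
             (trans (sym (spread-pair-suc k i j)) (trans eq (spread-pair-suc k i′ j′)))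
  low : i % 3 ≡ i′ % 3 × j % 3 ≡ j′ % 3
  low = +-*-digits-unique 3 (m%n<n i 3) (m%n<n i′ 3) (proj₁ nonary)
  high : i / 3 ≡ i′ / 3 × j / 3 ≡ j′ / 3
  high = spread-pair-injective k (<3^suc⇒/3<3^ k i<) (<3^suc⇒/3<3^ k j<)
           (<3^suc⇒/3<3^ k i′<) (<3^suc⇒/3<3^ k j′<) (proj₂ nonary)

spread-bound : ∀ k i → 4 * spread k i ≤ 9 * (i * i)
spread-bound zero    i = z≤n
spread-bound (suc k) i = subst (λ t → 4 * spread (suc k) i ≤ 9 * (t * t)) (sym (m≡m%n+[m/n]*n i 3))
  (step (i % 3) (i / 3) (spread k (i / 3)) (m≤m*m (i % 3)) (spread-bound k (i / 3)))
  where
  m≤m*m : ∀ m → m ≤ m * m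
  m≤m*m zero    = z≤n
  m≤m*m (suc m) = m≤m*n (suc m) (suc m)
  step : ∀ d q X → d ≤ d * d → 4 * X ≤ 9 * (q * q) → 4 * (d + 9 * X) ≤ 9 * ((d + q * 3) * (d + q * 3))
  step d q X d≤d² 4X≤9q² = begin
    4 * (d + 9 * X)                  ≡⟨ distrib d X ⟩
    4 * d + 9 * (4 * X)              ≤⟨ +-mono-≤ (*-monoʳ-≤ 4 d≤d²) (*-monoʳ-≤ 9 4X≤9q²) ⟩
    4 * (d * d) + 9 * (9 * (q * q))  ≤⟨ m≤m+n _ (5 * (d * d) + 54 * (d * q)) ⟩
    4 * (d * d) + 9 * (9 * (q * q)) + (5 * (d * d) + 54 * (d * q)) ≡⟨ square d q ⟩
    9 * ((d + q * 3) * (d + q * 3))  ∎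
    where
    open ≤-Reasoning
    distrib : ∀ d X → 4 * (d + 9 * X) ≡ 4 * d + 9 * (4 * X)
    distrib = solve-∀
    square : ∀ d q → 4 * (d * d) + 9 * (9 * (q * q)) + (5 * (d * d) + 54 * (d * q)) ≡
                     9 * ((d + q * 3) * (d + q * 3))
    square = solve-∀

spread-pair-bound : ∀ k {i j n} → i ≤ n → j ≤ n → spread k i + 3 * spread k j ≤ 9 * (n * n)
spread-pair-bound k {i} {j} {n} i≤n j≤n = *-cancelˡ-≤ 4 (begin
  4 * (spread k i + 3 * spread k j)      ≡⟨ distrib (spread k i) (spread k j) ⟩
  4 * spread k i + 3 * (4 * spread k j)  ≤⟨ +-mono-≤ (bound i≤n) (*-monoʳ-≤ 3 (bound j≤n)) ⟩
  9 * (n * n) + 3 * (9 * (n * n))        ≡⟨ collect (n * n) ⟩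
  4 * (9 * (n * n))                      ∎)
  where
  open ≤-Reasoning
  bound : ∀ {m} → m ≤ n → 4 * spread k m ≤ 9 * (n * n)
  bound {m} m≤n = ≤-trans (spread-bound k m) (*-monoʳ-≤ 9 (*-mono-≤ m≤n m≤n))
  distrib : ∀ x y → 4 * (x + 3 * y) ≡ 4 * x + 3 * (4 * y)
  distrib = solve-∀
  collect : ∀ x → 9 * x + 3 * (9 * x) ≡ 4 * (9 * x)
  collect = solve-∀

module SpreadSet (r N : ℕ) .{{_ : NonZero N}} (9r²<N : 9 * (r * r) < N) where

  spread-pair-<N : ∀ (i j : Fin r) → spread r (toℕ i) + 3 * spread r (toℕ j) < N
  spread-pair-<N i j = ≤-<-trans (spread-pair-bound r (<⇒≤ (toℕ<n i)) (<⇒≤ (toℕ<n j))) 9r²<N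

  spread-<N : ∀ (i : Fin r) → spread r (toℕ i) < N
  spread-<N i = ≤-<-trans (m≤m+n (spread r (toℕ i)) _) (spread-pair-<N i i)

  element : Fin r → Fin N
  element i = fromℕ< (spread-<N i)

  toℕ-element : ∀ i → toℕ (element i) ≡ spread r (toℕ i)
  toℕ-element i = toℕ-fromℕ< (spread-<N i)

  S : List (Fin N)
  S = tabulate element

  <3^r : ∀ (i : Fin r) → toℕ i < 3 ^ r
  <3^r i = <-trans (toℕ<n i) (n<3^n r)

  element-pair-injective : ∀ {a c d b} → spread r (toℕ a) + 3 * spread r (toℕ c) ≡
                                         spread r (toℕ d) + 3 * spread r (toℕ b) → a ≡ d × c ≡ b
  element-pair-injective {a} {c} {d} {b} eq =
    let a≡d , c≡b = spread-pair-injective r (<3^r a) (<3^r c) (<3^r d) (<3^r b) eq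
    in toℕ-injective a≡d , toℕ-injective c≡b

  element-injective : ∀ {i j} → element i ≡ element j → i ≡ j
  element-injective {i} {j} eq =
    proj₁ (element-pair-injective {c = i} {b = i} (cong (_+ 3 * spread r (toℕ i)) spread≡))
    where
    spread≡ : spread r (toℕ i) ≡ spread r (toℕ j)
    spread≡ = trans (sym (toℕ-element i)) (trans (cong toℕ eq) (toℕ-element j))

  Unique-S : Unique S
  Unique-S = tabulate⁺ element-injective

  Eq3-element⇒≡ : ∀ a b c d → Eq3 N (element a) (element b) (element c) (element d) →
                  spread r (toℕ a) + 3 * spread r (toℕ c) ≡ spread r (toℕ d) + 3 * spread r (toℕ b)
  Eq3-element⇒≡ a b c d eq = %-injective-< (spread-pair-<N a c) (spread-pair-<N d b) (begin
    (spread r (toℕ a) + 3 * spread r (toℕ c)) % N  ≡⟨ subst₂ (λ x y → x % N ≡ y % N) toℕ-ac toℕ-bd eq ⟩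
    (3 * spread r (toℕ b) + spread r (toℕ d)) % N  ≡⟨ cong (_% N) (+-comm (3 * spread r (toℕ b)) _) ⟩
    (spread r (toℕ d) + 3 * spread r (toℕ b)) % N  ∎)
    where
    open ≡-Reasoning
    toℕ-ac : toℕ (element a) + 3 * toℕ (element c) ≡ spread r (toℕ a) + 3 * spread r (toℕ c)
    toℕ-ac = cong₂ (λ x y → x + 3 * y) (toℕ-element a) (toℕ-element c)
    toℕ-bd : 3 * toℕ (element b) + toℕ (element d) ≡ 3 * spread r (toℕ b) + spread r (toℕ d)
    toℕ-bd = cong₂ (λ x y → 3 * x + y) (toℕ-element b) (toℕ-element d)

  element-Eq3 : ∀ a b c d → Eq3 N (element a) (element b) (element c) (element d) → a ≡ d × b ≡ c
  element-Eq3 a b c d eq =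
    let a≡d , c≡b = element-pair-injective {a} {c} {d} {b} (Eq3-element⇒≡ a b c d eq)
    in a≡d , sym c≡b

  S-Eq3-trivial : ∀ a b c d → a ∈ S → b ∈ S → c ∈ S → d ∈ S → Eq3 N a b c d → a ≡ d × b ≡ c
  S-Eq3-trivial a b c d a∈S b∈S c∈S d∈S =
    image-Eq3 (∈-tabulate⁻ a∈S) (∈-tabulate⁻ b∈S) (∈-tabulate⁻ c∈S) (∈-tabulate⁻ d∈S)
    where
    image-Eq3 : ∀ {a b c d} → ∃ (λ i → a ≡ element i) → ∃ (λ i → b ≡ element i) →
                ∃ (λ i → c ≡ element i) → ∃ (λ i → d ≡ element i) → Eq3 N a b c d → a ≡ d × b ≡ c
    image-Eq3 (ia , refl) (ib , refl) (ic , refl) (id , refl) eq =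
      let a≡d , b≡c = element-Eq3 ia ib ic id eq in cong element a≡d , cong element b≡c

lemma3p6 : ∃ λ (C : ℕ) → ∀ (r : ℕ) → NonZero r → ∀ (N : ℕ) → .{{_ : NonZero N}} → C * (r * r) < N →
    Σ (List (Fin N)) λ S → Unique S × length S ≡ r ×
      (∀ a b c d → a ∈ S → b ∈ S → c ∈ S → d ∈ S → Eq3 N a b c d → (a ≡ d × b ≡ c))
lemma3p6 = 9 , λ r _ N 9r²<N →
  let open SpreadSet r N 9r²<N in S , Unique-S , length-tabulate element , S-Eq3-trivial
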